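{- For every integer $a\ge 4$, Player 1 has a winning strategy in the $(a,4)$-game.
   Context: For positive integers $a,b$, the $(a,b)$-game is the following two-player game. Players 1 and 2 alternate moves, Player 1 moving first. After $n$ moves the game state is a permutation $\pi\in\mathcal{S}_n$ (the first move produces $\pi=1$). A move from $\pi\in\mathcal{S}_n$ consists of choosing any $m\in\{1,\dots,n+1\}$ and replacing $\pi$ by $\pi'=\pi'_1\cdots\pi'_n m\in\mathcal{S}_{n+1}$, where $\pi'_i=\pi_i$ if $\pi_i\le m-1$ and $\pi'_i=\pi_i+1$ if $\pi_i\ge m$. The game ends as soon as the current permutation contains an increasing subsequence of length $a$ or a decreasing subsequence of length $b$; the player who made that move loses (the other player wins). -}

module Defs where

open import Data.Nat using (ℕ; zero; suc; _≤_; _<_; _>_; _≤ᵇ_)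
open import Data.Bool using (if_then_else_)
open import Data.List using (List; []; _∷_; map; _++_; [_]; length)
open import Data.List.Relation.Binary.Sublist.Propositional using (_⊆_)
open import Data.List.Relation.Unary.Linked using (Linked)
open import Data.Product using (Σ; _×_)
open import Data.Sum using (_⊎_)
open import Relation.Binary.PropositionalEquality using (_≡_)
open import Relation.Nullary using (¬_)

-- A permutation π ∈ S_n is represented by its one-line notation
-- π₁ ⋯ πₙ as a list of naturals (values 1..n).  The game starts from the
-- empty permutation (n = 0); the first move necessarily produces [1].

bump : ℕ → ℕ → ℕ
bump m x = if m ≤ᵇ x then suc x else x

move : List ℕ → ℕ → List ℕ
move π m = map (bump m) π ++ [ m ]

HasIncreasing : ℕ → List ℕ → Set
HasIncreasing a π = Σ (List ℕ) λ s → s ⊆ π × length s ≡ a × Linked _<_ s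

HasDecreasing : ℕ → List ℕ → Set
HasDecreasing b π = Σ (List ℕ) λ s → s ⊆ π × length s ≡ b × Linked _>_ s

Ended : ℕ → ℕ → List ℕ → Set
Ended a b π = HasIncreasing a π ⊎ HasDecreasing b π

-- The definitions are inductive (well-founded strategies); the game is
-- finite by Erdős–Szekeres, so this is the usual notion.
mutual
  data Win (a b : ℕ) (π : List ℕ) : Set where
    win : (m : ℕ) → 1 ≤ m → m ≤ suc (length π) →
          ¬ Ended a b (move π m) → Lose a b (move π m) → Win a b π

  data Lose (a b : ℕ) (π : List ℕ) : Set where
    lose : ((m : ℕ) → 1 ≤ m → m ≤ suc (length π) →
             Ended a b (move π m) ⊎ Win a b (move π m)) → Lose a b π

Player1Wins : ℕ → ℕ → Set
Player1Wins a b = Win a b []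

-- Track a permutation π ∈ Sₙ by its profile: for each of the n + 1 gaps
-- between consecutive values, the lengths (f , g) of the longest increasing
-- subsequence below the gap and of the longest decreasing one above it.  A
-- move into a gap with pair (f , g) ends the game iff f + 1 = a or g + 1 = b,
-- and the next profile depends on the old profile alone: the played gap
-- splits in two, the gaps below it have g raised to at least g + 1 and those
-- above it have f raised to at least f + 1.  So the game is a game on
-- profiles.  For b = 4, Player 1 wins looking only at the sequence of
-- distinct live pairs, never at how many gaps share a pair: after the first
-- move Player 2 faces (0,1)(1,0), and Player 1 answers every move so that
-- Player 2 again faces
--   A k = (k,2)(k,1)(k+1,0)   or   B k = (k,2)(k+1,2)(k+2,1)(k+2,0)
-- with k growing, until the live pairs run out and every move left to
-- Player 2 loses.

{-# OPTIONS --safe #-}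
module Submission where

open import Data.Bool using (true; false)
open import Data.List using (List; []; _∷_; [_]; _++_; map; length)
open import Data.List.Properties using (length-map; length-++; map-++; ++-assoc)
open import Data.List.Relation.Binary.Sublist.Propositional using (_⊆_; []; _∷_; _∷ʳ_)
import Data.List.Relation.Binary.Sublist.Propositional.Properties as Sublistₚ
open import Data.List.Relation.Unary.All as All using (All; []; _∷_)
import Data.List.Relation.Unary.All.Properties as Allₚ
open import Data.List.Relation.Unary.Linked as Linked using (Linked; []; [-]; _∷_)
import Data.List.Relation.Unary.Linked.Properties as Linkedₚ
open import Data.Maybe using (Maybe; just; nothing)
open import Data.Nat
  using (ℕ; zero; suc; pred; _+_; _⊔_; _≤_; _<_; _>_; z≤n; s≤s; s≤s⁻¹; _≤ᵇ_; _<?_)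
open import Data.Nat.Properties
  using ( ≤-refl; ≤-reflexive; ≤-trans; ≤-antisym; <-trans; <-≤-trans; ≤-<-trans; <-asym; <-irrefl
        ; <⇒≱; ≰⇒>; ≮⇒≥; <⇒≤pred; n≤1+n; n<1+n; m≤m+n; m≤n⇒m≤1+n; m≤n⇒∃[o]m+o≡n
        ; m≥n⇒m⊔n≡m; m≤m⊔n; m≤n⊔m; ⊔-lub; ⊔-sel; +-distribʳ-⊔
        ; +-identityʳ; +-comm; +-suc; suc-injective; +-monoʳ-<; +-cancelˡ-<
        ; ≤ᵇ-reflects-≤; module ≤-Reasoning )
open import Data.Product using (_×_; _,_; proj₁; proj₂; ∃; ∃₂)
open import Data.Sum using (_⊎_; inj₁; inj₂)
open import Data.Unit using (⊤; tt)
open import Function using (_∘_; _on_)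
open import Level using (0ℓ)
open import Relation.Binary using (Rel; Transitive; _⇔_)
open import Relation.Binary.PropositionalEquality using (_≡_; refl; sym; trans; cong; subst)
open import Relation.Nullary using (¬_; Dec; yes; no; contradiction)
open import Relation.Nullary.Decidable using (_×-dec_)
open import Relation.Nullary.Reflects using (ofʸ; ofⁿ)
open import Relation.Unary using (_≐_)

open import Defs

shift-⊔ : ∀ c₁ c₂ {k} → (c₁ + k) ⊔ (c₂ + k) ≡ (c₁ ⊔ c₂) + k
shift-⊔ c₁ c₂ {k} = sym (+-distribʳ-⊔ k c₁ c₂)

suc-pred≮ : ∀ c → ¬ suc (pred c) < c
suc-pred≮ zero    ()
suc-pred≮ (suc c) = <-irrefl refl

module _ {A : Set} where

  length-++[-] : ∀ (s : List A) {y} → length (s ++ [ y ]) ≡ suc (length s)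
  length-++[-] s = trans (length-++ s) (+-comm (length s) 1)

  ⊆-++[-]⁻ : ∀ {s : List A} xs {y} → s ⊆ xs ++ [ y ] →
             s ⊆ xs ⊎ ∃ λ s₀ → s ≡ s₀ ++ [ y ] × s₀ ⊆ xs
  ⊆-++[-]⁻ []       (_ ∷ʳ [])   = inj₁ []
  ⊆-++[-]⁻ []       (refl ∷ []) = inj₂ ([] , refl , [])
  ⊆-++[-]⁻ (x ∷ xs) (.x ∷ʳ p) with ⊆-++[-]⁻ xs p
  ... | inj₁ q             = inj₁ (x ∷ʳ q)
  ... | inj₂ (s₀ , eq , q) = inj₂ (s₀ , eq , x ∷ʳ q)
  ⊆-++[-]⁻ (x ∷ xs) (refl ∷ p) with ⊆-++[-]⁻ xs p
  ... | inj₁ q               = inj₁ (refl ∷ q)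
  ... | inj₂ (s₀ , refl , q) = inj₂ (x ∷ s₀ , refl , refl ∷ q)

  ⊆-map⁻ : ∀ {B : Set} {s : List B} (h : A → B) xs → s ⊆ map h xs →
           ∃ λ s′ → s ≡ map h s′ × s′ ⊆ xs
  ⊆-map⁻ h []       []         = [] , refl , []
  ⊆-map⁻ h (x ∷ xs) (_ ∷ʳ p) with ⊆-map⁻ h xs p
  ... | s′ , eq , q = s′ , eq , x ∷ʳ q
  ⊆-map⁻ h (x ∷ xs) (refl ∷ p) with ⊆-map⁻ h xs p
  ... | s′ , refl , q = x ∷ s′ , refl , refl ∷ q

  All≡-split : ∀ {x : A} {G m} → All (_≡ x) G → m < length G →
               ∃₂ λ L R → G ≡ L ++ x ∷ R × length L ≡ m × All (_≡ x) L × All (_≡ x) R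
  All≡-split {m = zero}  (refl ∷ xs) _ = [] , _ , refl , refl , [] , xs
  All≡-split {m = suc m} (y≡x ∷ xs) m<G with All≡-split xs (s≤s⁻¹ m<G)
  ... | L , R , refl , refl , L≡x , R≡x = _ ∷ L , R , refl , refl , y≡x ∷ L≡x , R≡x

  module _ {R : Rel A 0ℓ} where

    Linked-++[-]⁻ : Transitive R → ∀ s {y} → Linked R (s ++ [ y ]) →
                    Linked R s × All (λ z → R z y) s
    Linked-++[-]⁻ R-trans []          _         = [] , []
    Linked-++[-]⁻ R-trans (z ∷ [])    (r ∷ [-]) = [-] , r ∷ []
    Linked-++[-]⁻ R-trans (z ∷ w ∷ s) (r ∷ l) with Linked-++[-]⁻ R-trans (w ∷ s) l
    ... | l′ , (r′ ∷ rs) = r ∷ l′ , R-trans r r′ ∷ r′ ∷ rs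

    Linked-++[-]⁺ : ∀ {s y} → Linked R s → All (λ z → R z y) s → Linked R (s ++ [ y ])
    Linked-++[-]⁺ []      []       = [-]
    Linked-++[-]⁺ [-]     (r ∷ []) = r ∷ [-]
    Linked-++[-]⁺ (r ∷ l) (_ ∷ rs) = r ∷ Linked-++[-]⁺ l rs

module Chains {A : Set} (R : Rel A 0ℓ) (R-trans : Transitive R) where

  ChainIn : (A → Set) → List A → List A → Set
  ChainIn P xs s = s ⊆ xs × Linked R s × All P s

  HasChain : (A → Set) → List A → ℕ → Set
  HasChain P xs k = ∃ λ s → ChainIn P xs s × length s ≡ k

  LongestChain : (A → Set) → List A → ℕ → Set
  LongestChain P xs k = (∀ {s} → ChainIn P xs s → length s ≤ k) × HasChain P xs k

  longestChain-[] : ∀ {P} → LongestChain P [] 0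
  longestChain-[] = (λ { ([] , _) → z≤n }) , [] , ([] , [] , []) , refl

  longestChain⇒Linked : ∀ {P xs k} → LongestChain P xs k →
                        ∃ λ s → s ⊆ xs × length s ≡ k × Linked R s
  longestChain⇒Linked (_ , s , (sub , lk , _) , len) = s , sub , len , lk

  longestChain-⊔ : ∀ {P xs k l} → (∀ {s} → ChainIn P xs s → length s ≤ k ⊔ l) →
                   HasChain P xs k → HasChain P xs l → LongestChain P xs (k ⊔ l)
  longestChain-⊔ {k = k} {l} bounded cₖ cₗ with k ⊔ l | ⊔-sel k l
  ... | _ | inj₁ refl = bounded , cₖ
  ... | _ | inj₂ refl = bounded , cₗ

  -- A move relabels the old entries by an order embedding h and appends y.
  -- A longest restricted chain is unchanged when y is excluded (∉); when y is
  -- admitted (∈) the chain may also end at y, after a chain lying R-below y.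
  module _ {h : A → A} (h-emb : (R on h) ⇔ R) {y : A} {xs : List A} where

    private
      unmap : ∀ {P Q : A → Set} {s} → (∀ {x} → Q (h x) → P x) →
              s ⊆ map h xs → Linked R s → All Q s → ∃ λ s′ → s ≡ map h s′ × ChainIn P xs s′
      unmap Qh⇒P sub lk qs with ⊆-map⁻ h xs sub
      ... | s′ , refl , sub′ =
        s′ , refl , sub′ , Linked.map (proj₁ h-emb) (Linkedₚ.map⁻ lk) , All.map Qh⇒P (Allₚ.map⁻ qs)

      push : ∀ {P Q : A → Set} {s} → (∀ {x} → P x → Q (h x)) →
             ChainIn P xs s → ChainIn Q (map h xs ++ [ y ]) (map h s)
      push P⇒Qh (sub , lk , ps) =
        Sublistₚ.++⁺ʳ [ y ] (Sublistₚ.map⁺ h sub) ,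
        Linkedₚ.map⁺ (Linked.map (proj₂ h-emb) lk) ,
        Allₚ.map⁺ (All.map P⇒Qh ps)

      push-++[-] : ∀ {P Q : A → Set} {s} → Q y → (∀ {z} → R z y → Q z) →
                   (∀ {x} → P x → R (h x) y) →
                   ChainIn P xs s → ChainIn Q (map h xs ++ [ y ]) (map h s ++ [ y ])
      push-++[-] Qy below⇒Q P⇒Rh (sub , lk , ps) =
        Sublistₚ.++⁺ (Sublistₚ.map⁺ h sub) (refl ∷ []) ,
        Linked-++[-]⁺ (Linkedₚ.map⁺ (Linked.map (proj₂ h-emb) lk))
                      (Allₚ.map⁺ (All.map P⇒Rh ps)) ,
        Allₚ.++⁺ (Allₚ.map⁺ (All.map (λ p → below⇒Q (P⇒Rh p)) ps)) (Qy ∷ [])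

    longestChain-++[-]-∉ : ∀ {P Q : A → Set} {k} → ¬ Q y → (Q ∘ h) ≐ P →
                           LongestChain P xs k → LongestChain Q (map h xs ++ [ y ]) k
    longestChain-++[-]-∉ ¬Qy (Qh⇒P , P⇒Qh) (bounded , s , c , refl) =
      bounded′ , map h s , push P⇒Qh c , length-map h s
      where
        bounded′ : ∀ {t} → ChainIn _ (map h xs ++ [ y ]) t → length t ≤ length s
        bounded′ (sub , lk , qs) with ⊆-++[-]⁻ (map h xs) sub
        ... | inj₁ sub₀ with unmap Qh⇒P sub₀ lk qs
        ...   | t′ , refl , c′ = ≤-trans (≤-reflexive (length-map h t′)) (bounded c′)
        bounded′ (sub , lk , qs) | inj₂ (t₀ , refl , _) with Allₚ.++⁻ʳ t₀ qs
        ... | Qy ∷ [] = contradiction Qy ¬Qy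

    longestChain-++[-]-∈ : ∀ {P P₀ Q : A → Set} {k k₀} → Q y → (∀ {z} → R z y → Q z) →
                           (Q ∘ h) ≐ P → ((λ x → R x y) ∘ h) ≐ P₀ →
                           LongestChain P xs k → LongestChain P₀ xs k₀ →
                           LongestChain Q (map h xs ++ [ y ]) (k ⊔ suc k₀)
    longestChain-++[-]-∈ Qy below⇒Q (Qh⇒P , P⇒Qh) (Rh⇒P₀ , P₀⇒Rh)
                         (bounded , s , c , refl) (bounded₀ , s₀ , c₀ , refl) =
      longestChain-⊔ bounded′
        (map h s , push P⇒Qh c , length-map h s)
        (map h s₀ ++ [ y ] , push-++[-] Qy below⇒Q P₀⇒Rh c₀ ,
         trans (length-++[-] (map h s₀)) (cong suc (length-map h s₀)))
      where
        open ≤-Reasoning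
        bounded′ : ∀ {t} → ChainIn _ (map h xs ++ [ y ]) t →
                   length t ≤ length s ⊔ suc (length s₀)
        bounded′ (sub , lk , qs) with ⊆-++[-]⁻ (map h xs) sub
        ... | inj₁ sub₀ with unmap Qh⇒P sub₀ lk qs
        ...   | t′ , refl , c′ = begin
          length (map h t′)          ≡⟨ length-map h t′ ⟩
          length t′                  ≤⟨ bounded c′ ⟩
          length s                   ≤⟨ m≤m⊔n _ _ ⟩
          length s ⊔ suc (length s₀) ∎
        bounded′ (sub , lk , qs) | inj₂ (t₀ , refl , sub₀) with Linked-++[-]⁻ R-trans t₀ lk
        ... | lk₀ , below with unmap Rh⇒P₀ sub₀ lk₀ below
        ...   | t′ , refl , c′ = begin
          length (map h t′ ++ [ y ])  ≡⟨ length-++[-] (map h t′) ⟩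
          suc (length (map h t′))     ≡⟨ cong suc (length-map h t′) ⟩
          suc (length t′)             ≤⟨ s≤s (bounded₀ c′) ⟩
          suc (length s₀)             ≤⟨ m≤n⊔m _ _ ⟩
          length s ⊔ suc (length s₀)  ∎

data BumpView (m x : ℕ) : ℕ → Set where
  kept   : x ≤ m → BumpView m x x
  raised : m < x → BumpView m x (suc x)

bump-view : ∀ m x → BumpView m x (bump (suc m) x)
bump-view m x with suc m ≤ᵇ x | ≤ᵇ-reflects-≤ (suc m) x
... | true  | ofʸ m<x = raised m<x
... | false | ofⁿ m≮x = kept (s≤s⁻¹ (≰⇒> m≮x))

module _ {m : ℕ} where

  private
    h : ℕ → ℕ
    h = bump (suc m)

  bump-kept : ∀ {x} → x ≤ m → h x ≡ x
  bump-kept {x} x≤m with h x | bump-view m x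
  ... | _ | kept _     = refl
  ... | _ | raised m<x = contradiction x≤m (<⇒≱ m<x)

  bump-raised : ∀ {x} → m < x → h x ≡ suc x
  bump-raised {x} m<x with h x | bump-view m x
  ... | _ | kept x≤m = contradiction x≤m (<⇒≱ m<x)
  ... | _ | raised _ = refl

  ≤-bump : ∀ {x} → x ≤ h x
  ≤-bump {x} with h x | bump-view m x
  ... | _ | kept _   = ≤-refl
  ... | _ | raised _ = n≤1+n x

  bump-≤-suc : ∀ {x} → h x ≤ suc x
  bump-≤-suc {x} with h x | bump-view m x
  ... | _ | kept _   = n≤1+n x
  ... | _ | raised _ = ≤-refl

  bump-<-⇔ : (_<_ on h) ⇔ _<_
  bump-<-⇔ = reflect , preserve
    where
      reflect : ∀ {x y} → h x < h y → x < y
      reflect {x} {y} with h x | bump-view m x | h y | bump-view m y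
      ... | _ | kept _     | _ | kept _     = λ x<y → x<y
      ... | _ | kept x≤m   | _ | raised m<y = λ _ → ≤-<-trans x≤m m<y
      ... | _ | raised m<x | _ | kept y≤m   =
        λ sx<y → contradiction (<-≤-trans (<-trans (n<1+n x) sx<y) y≤m) (<-asym m<x)
      ... | _ | raised _   | _ | raised _   = s≤s⁻¹
      preserve : ∀ {x y} → x < y → h x < h y
      preserve {x} {y} x<y with h x | bump-view m x | h y | bump-view m y
      ... | _ | kept _     | _ | kept _     = x<y
      ... | _ | kept _     | _ | raised _   = m≤n⇒m≤1+n x<y
      ... | _ | raised m<x | _ | kept y≤m   =
        contradiction (<-≤-trans (<-trans m<x x<y) y≤m) (<-irrefl refl)
      ... | _ | raised _   | _ | raised _   = s≤s x<y

  bump->-⇔ : (_>_ on h) ⇔ _>_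
  bump->-⇔ = proj₁ bump-<-⇔ , proj₂ bump-<-⇔

  bump-≤-below : ∀ {j} → j ≤ m → ((_≤ j) ∘ h) ≐ (_≤ j)
  bump-≤-below j≤m = (λ hx≤j → ≤-trans ≤-bump hx≤j) ,
                     (λ x≤j → subst (_≤ _) (sym (bump-kept (≤-trans x≤j j≤m))) x≤j)

  bump->-below : ∀ {j} → j ≤ m → ((j <_) ∘ h) ≐ (j <_)
  bump->-below {j} j≤m = to , (λ j<x → <-≤-trans j<x ≤-bump)
    where
      to : ∀ {x} → j < h x → j < x
      to {x} with h x | bump-view m x
      ... | _ | kept _     = λ j<x → j<x
      ... | _ | raised m<x = λ _ → ≤-<-trans j≤m m<x

  bump-≤-above : ∀ {j} → m ≤ j → ((_≤ suc j) ∘ h) ≐ (_≤ j)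
  bump-≤-above {j} m≤j = to , (λ x≤j → ≤-trans bump-≤-suc (s≤s x≤j))
    where
      to : ∀ {x} → h x ≤ suc j → x ≤ j
      to {x} with h x | bump-view m x
      ... | _ | kept x≤m = λ _ → ≤-trans x≤m m≤j
      ... | _ | raised _ = s≤s⁻¹

  bump->-above : ∀ {j} → m ≤ j → ((suc j <_) ∘ h) ≐ (j <_)
  bump->-above m≤j = (λ sj<hx → s≤s⁻¹ (<-≤-trans sj<hx bump-≤-suc)) ,
                     (λ j<x → subst (_ <_) (sym (bump-raised (≤-<-trans m≤j j<x))) (s≤s j<x))

  bump-<-new : ((_< suc m) ∘ h) ≐ (_≤ m)
  bump-<-new = (λ hx<sm → s≤s⁻¹ (≤-<-trans ≤-bump hx<sm)) ,
               (λ x≤m → subst (_< _) (sym (bump-kept x≤m)) (s≤s x≤m))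

-- Gap j of a permutation π ∈ Sₙ (0 ≤ j ≤ n) is the slot taken by the next
-- entry when the move appends the value j + 1.  Its pair (f , g) records the
-- longest increasing subsequence of π with values ≤ j and the longest
-- decreasing one with values > j: a move into the gap creates monotone
-- subsequences of lengths exactly f + 1 and g + 1 through the new entry.
Gap : Set
Gap = ℕ × ℕ

module Increasing = Chains _<_ <-trans
module Decreasing = Chains _>_ (λ y<x z<y → <-trans z<y y<x)

IsGap : List ℕ → ℕ → Gap → Set
IsGap π j (f , g) = Increasing.LongestChain (_≤ j) π f × Decreasing.LongestChain (j <_) π g

gapBelow gapAbove : Gap → Gap → Gap
gapBelow (f , g) (f′ , g′) = f′ , g′ ⊔ suc g
gapAbove (f , g) (f′ , g′) = f′ ⊔ suc f , g′

module _ (π : List ℕ) {m : ℕ} where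

  isGap-below : ∀ {j x y} → j ≤ m → IsGap π m x → IsGap π j y →
                IsGap (move π (suc m)) j (gapBelow x y)
  isGap-below j≤m (_ , decₘ) (incⱼ , decⱼ) =
    Increasing.longestChain-++[-]-∉ bump-<-⇔ (<⇒≱ (s≤s j≤m)) (bump-≤-below j≤m) incⱼ ,
    Decreasing.longestChain-++[-]-∈ bump->-⇔ (s≤s j≤m) (λ sm<z → <-trans (s≤s j≤m) sm<z)
      (bump->-below j≤m) (bump->-above ≤-refl) decⱼ decₘ

  isGap-above : ∀ {j x y} → m ≤ j → IsGap π m x → IsGap π j y →
                IsGap (move π (suc m)) (suc j) (gapAbove x y)
  isGap-above m≤j (incₘ , _) (incⱼ , decⱼ) =
    Increasing.longestChain-++[-]-∈ bump-<-⇔ (s≤s m≤j)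
      (λ z<sm → ≤-trans (s≤s⁻¹ z<sm) (m≤n⇒m≤1+n m≤j))
      (bump-≤-above m≤j) bump-<-new incⱼ incₘ ,
    Decreasing.longestChain-++[-]-∉ bump->-⇔ (λ sj<sm → <⇒≱ (s≤s⁻¹ sj<sm) m≤j)
      (bump->-above m≤j) decⱼ

GapsFrom : List ℕ → ℕ → List Gap → Set
GapsFrom π j []      = ⊤
GapsFrom π j (y ∷ G) = IsGap π j y × GapsFrom π (suc j) G

IsProfile : List ℕ → List Gap → Set
IsProfile π G = length G ≡ suc (length π) × GapsFrom π 0 G

-- Out of range the value (0 , 0) is junk; every use carries m < length G.
gapAt : List Gap → ℕ → Gap
gapAt []      m       = 0 , 0
gapAt (y ∷ G) zero    = y
gapAt (y ∷ G) (suc m) = gapAt G m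

-- The played gap splits into the two gaps on either side of the new entry.
playAt : Gap → ℕ → List Gap → List Gap
playAt x m       []      = []
playAt x zero    (y ∷ G) = gapBelow x y ∷ map (gapAbove x) (y ∷ G)
playAt x (suc m) (y ∷ G) = gapBelow x y ∷ playAt x m G

play : List Gap → ℕ → List Gap
play G m = playAt (gapAt G m) m G

gapAt-++ˡ : ∀ G₁ {G₂ m} → m < length G₁ → gapAt (G₁ ++ G₂) m ≡ gapAt G₁ m
gapAt-++ˡ (y ∷ G₁) {m = zero}  _     = refl
gapAt-++ˡ (y ∷ G₁) {m = suc m} m<G₁ = gapAt-++ˡ G₁ (s≤s⁻¹ m<G₁)

gapAt-++ʳ : ∀ G₁ {G₂ m} → gapAt (G₁ ++ G₂) (length G₁ + m) ≡ gapAt G₂ m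
gapAt-++ʳ []       = refl
gapAt-++ʳ (y ∷ G₁) = gapAt-++ʳ G₁

playAt-++ʳ : ∀ x G₁ {G₂ m} →
             playAt x (length G₁ + m) (G₁ ++ G₂) ≡ map (gapBelow x) G₁ ++ playAt x m G₂
playAt-++ʳ x []       = refl
playAt-++ʳ x (y ∷ G₁) = cong (gapBelow x y ∷_) (playAt-++ʳ x G₁)

gapAt-All : ∀ {P : Gap → Set} {G m} → All P G → m < length G → P (gapAt G m)
gapAt-All {m = zero}  (p ∷ _)  _   = p
gapAt-All {m = suc m} (_ ∷ ps) m<G = gapAt-All ps (s≤s⁻¹ m<G)

length-playAt : ∀ x m G → m < length G → length (playAt x m G) ≡ suc (length G)
length-playAt x zero    (y ∷ G) _   = cong (suc ∘ suc) (length-map (gapAbove x) G)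
length-playAt x (suc m) (y ∷ G) m<G = cong suc (length-playAt x m G (s≤s⁻¹ m<G))

length-move : ∀ π M → length (move π M) ≡ suc (length π)
length-move π M = trans (length-++[-] (map (bump M) π)) (cong suc (length-map (bump M) π))

InRange : List ℕ → Set
InRange π = All (λ v → 0 < v × v ≤ length π) π

inRange-move : ∀ {π m} → InRange π → m ≤ length π → InRange (move π (suc m))
inRange-move {π} {m} range m≤π rewrite length-move π (suc m) =
  Allₚ.++⁺ (Allₚ.map⁺ (All.map bumped range)) ((s≤s z≤n , s≤s m≤π) ∷ [])
  where
    bumped : ∀ {v} → 0 < v × v ≤ length π → 0 < bump (suc m) v × bump (suc m) v ≤ suc (length π)
    bumped (0<v , v≤π) = <-≤-trans 0<v ≤-bump , ≤-trans bump-≤-suc (s≤s v≤π)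

module _ {π : List ℕ} where

  gapsFrom-gap : ∀ {j G} m → GapsFrom π j G → m < length G → IsGap π (j + m) (gapAt G m)
  gapsFrom-gap {j} {y ∷ G} zero    (gⱼ , _) _ = subst (λ i → IsGap π i y) (sym (+-identityʳ j)) gⱼ
  gapsFrom-gap {j} {y ∷ G} (suc m) (_ , gs) m<G =
    subst (λ i → IsGap π i (gapAt G m)) (sym (+-suc j m)) (gapsFrom-gap m gs (s≤s⁻¹ m<G))

  isProfile-gap : ∀ {G m} → IsProfile π G → m < length G → IsGap π m (gapAt G m)
  isProfile-gap {m = m} (_ , gs) = gapsFrom-gap m gs

  module _ {μ x} (gₘ : IsGap π μ x) where

    gapsFrom-above : ∀ {j} G → μ ≤ j → GapsFrom π j G →
                     GapsFrom (move π (suc μ)) (suc j) (map (gapAbove x) G)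
    gapsFrom-above []      _   _         = tt
    gapsFrom-above (y ∷ G) μ≤j (gⱼ , gs) =
      isGap-above π μ≤j gₘ gⱼ , gapsFrom-above G (m≤n⇒m≤1+n μ≤j) gs

    gapsFrom-playAt : ∀ {j} m G → j + m ≡ μ → GapsFrom π j G →
                      GapsFrom (move π (suc μ)) j (playAt x m G)
    gapsFrom-playAt m       []      _  _         = tt
    gapsFrom-playAt {j} zero (y ∷ G) eq gs@(gⱼ , _) =
      isGap-below π j≤μ gₘ gⱼ , gapsFrom-above (y ∷ G) (≤-reflexive (sym j≡μ)) gs
      where
        j≡μ = trans (sym (+-identityʳ j)) eq
        j≤μ = ≤-reflexive j≡μ
    gapsFrom-playAt {j} (suc m) (y ∷ G) eq (gⱼ , gs) =
      isGap-below π (subst (j ≤_) eq (m≤m+n j (suc m))) gₘ gⱼ ,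
      gapsFrom-playAt m G (trans (sym (+-suc j m)) eq) gs

  isProfile-play : ∀ {G m} → IsProfile π G → m < length G →
                   IsProfile (move π (suc m)) (play G m)
  isProfile-play {G} {m} p@(len , gs) m<G =
    trans (length-playAt (gapAt G m) m G m<G) (cong suc (trans len (sym (length-move π (suc m))))) ,
    gapsFrom-playAt (isProfile-gap p m<G) m G refl gs

  increasing-≤-top : ∀ {G s} → IsProfile π G → InRange π → s ⊆ π → Linked _<_ s →
                     length s ≤ proj₁ (gapAt G (length π))
  increasing-≤-top p@(len , _) range sub lk =
    proj₁ (proj₁ (isProfile-gap p (subst (length π <_) (sym len) ≤-refl)))
      (sub , lk , Sublistₚ.All-resp-⊆ sub (All.map proj₂ range))

  decreasing-≤-bottom : ∀ {G s} → IsProfile π G → InRange π → s ⊆ π → Linked _>_ s →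
                        length s ≤ proj₂ (gapAt G 0)
  decreasing-≤-bottom p@(len , _) range sub lk =
    proj₁ (proj₂ (isProfile-gap p (subst (0 <_) (sym len) (s≤s z≤n))))
      (sub , lk , Sublistₚ.All-resp-⊆ sub (All.map proj₁ range))

  -- The gaps on either side of the new entry carry its chains of lengths
  -- f + 1 and g + 1.
  increasing-through : ∀ {m f g} → IsGap π m (f , g) → HasIncreasing (suc f) (move π (suc m))
  increasing-through gₘ = subst (λ k → HasIncreasing k _) (shift-⊔ 0 1)
    (Increasing.longestChain⇒Linked (proj₁ (isGap-above π ≤-refl gₘ gₘ)))

  decreasing-through : ∀ {m f g} → IsGap π m (f , g) → HasDecreasing (suc g) (move π (suc m))
  decreasing-through gₘ = subst (λ k → HasDecreasing k _) (shift-⊔ 0 1)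
    (Decreasing.longestChain⇒Linked (proj₂ (isGap-below π ≤-refl gₘ gₘ)))

module ProfileGame (a b : ℕ) where

  Safe : Gap → Set
  Safe (f , g) = suc f < a × suc g < b

  safe? : ∀ x → Dec (Safe x)
  safe? (f , g) = suc f <? a ×-dec suc g <? b

  Bounded : Gap → Set
  Bounded (f , g) = f < a × g < b

  bounded-gapBelow : ∀ {x y} → Safe x → Bounded y → Bounded (gapBelow x y)
  bounded-gapBelow (_ , sg<b) (f<a , g<b) = f<a , ⊔-lub g<b sg<b

  bounded-gapAbove : ∀ {x y} → Safe x → Bounded y → Bounded (gapAbove x y)
  bounded-gapAbove (sf<a , _) (f<a , g<b) = ⊔-lub f<a sf<a , g<b

  bounded-playAt : ∀ {x} m {G} → Safe x → All Bounded G → All Bounded (playAt x m G)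
  bounded-playAt m       {[]}    _  _           = []
  bounded-playAt zero    {y ∷ G} sx bs@(by ∷ _) =
    bounded-gapBelow sx by ∷ Allₚ.map⁺ (All.map (bounded-gapAbove sx) bs)
  bounded-playAt (suc m) {y ∷ G} sx (by ∷ bs)   =
    bounded-gapBelow sx by ∷ bounded-playAt m sx bs

  mutual
    data ProfileWin (G : List Gap) : Set where
      win-at : ∀ m → m < length G → Safe (gapAt G m) → ProfileLose (play G m) → ProfileWin G

    data ProfileLose (G : List Gap) : Set where
      lose-by : (∀ m → m < length G → ¬ Safe (gapAt G m) ⊎ ProfileWin (play G m)) →
                ProfileLose G

  record Represents (π : List ℕ) (G : List Gap) : Set where
    field
      profile : IsProfile π G
      inRange : InRange π
      bounded : All Bounded G

  open Represents

  represents-[] : 0 < a → 0 < b → Represents [] [ (0 , 0) ]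
  represents-[] 0<a 0<b = record
    { profile = refl , (Increasing.longestChain-[] , Decreasing.longestChain-[]) , tt
    ; inRange = []
    ; bounded = (0<a , 0<b) ∷ []
    }

  represents-play : ∀ {π G m} → Represents π G → m < length G → Safe (gapAt G m) →
                    Represents (move π (suc m)) (play G m)
  represents-play {π} {G} {m} r m<G safe = record
    { profile = isProfile-play (profile r) m<G
    ; inRange = inRange-move (inRange r) (s≤s⁻¹ (subst (m <_) (proj₁ (profile r)) m<G))
    ; bounded = bounded-playAt m safe (bounded r)
    }

  not-ended : ∀ {π G} → Represents π G → ¬ Ended a b π
  not-ended r (inj₁ (s , sub , len , lk)) =
    <⇒≱ (proj₁ (gapAt-All (bounded r) top))
        (subst (_≤ _) len (increasing-≤-top (profile r) (inRange r) sub lk))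
    where top = subst (_ <_) (sym (proj₁ (profile r))) ≤-refl
  not-ended r (inj₂ (s , sub , len , lk)) =
    <⇒≱ (proj₂ (gapAt-All (bounded r) bottom))
        (subst (_≤ _) len (decreasing-≤-bottom (profile r) (inRange r) sub lk))
    where bottom = subst (0 <_) (sym (proj₁ (profile r))) (s≤s z≤n)

  ended-if-unsafe : ∀ {π G m} → Represents π G → m < length G → ¬ Safe (gapAt G m) →
                    Ended a b (move π (suc m))
  ended-if-unsafe {π} {G} {m} r m<G unsafe
    with gapAt G m | isProfile-gap (profile r) m<G | gapAt-All (bounded r) m<G
  ... | f , g | gₘ | f<a , g<b with suc f <? a | suc g <? b
  ... | no sf≮a  | _        =
    inj₁ (subst (λ k → HasIncreasing k _) (≤-antisym f<a (≮⇒≥ sf≮a)) (increasing-through gₘ))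
  ... | yes _    | no sg≮b  =
    inj₂ (subst (λ k → HasDecreasing k _) (≤-antisym g<b (≮⇒≥ sg≮b)) (decreasing-through gₘ))
  ... | yes sf<a | yes sg<b = contradiction (sf<a , sg<b) unsafe

  mutual
    win-from : ∀ {π G} → Represents π G → ProfileWin G → Win a b π
    win-from r (win-at m m<G safe loses) =
      win (suc m) (s≤s z≤n) (subst (m <_) (proj₁ (profile r)) m<G)
          (not-ended r′) (lose-from r′ loses)
      where r′ = represents-play r m<G safe

    lose-from : ∀ {π G} → Represents π G → ProfileLose G → Lose a b π
    lose-from {π} {G} r (lose-by replies) =
      lose λ { zero () _
             ; (suc m) _ sm≤sπ → reply m (subst (m <_) (sym (proj₁ (profile r))) sm≤sπ) }
      where
        reply : ∀ m → m < length G → Ended a b (move π (suc m)) ⊎ Win a b (move π (suc m))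
        reply m m<G with safe? (gapAt G m) | replies m m<G
        ... | no unsafe | _          = inj₁ (ended-if-unsafe r m<G unsafe)
        ... | yes safe  | inj₁ unsafe = contradiction safe unsafe
        ... | yes safe  | inj₂ w      = inj₂ (win-from (represents-play r m<G safe) w)

module Shapes (a b : ℕ) where

  open ProfileGame a b

  -- A shape lists a profile's blocks: nonempty runs of equal live pairs, and
  -- the dead gaps at either end, where every move loses.
  data Block : Set where
    lowDead highDead : Block
    run : Gap → Block

  BlockFits : Block → List Gap → Set
  BlockFits lowDead  G = All (λ y → proj₂ y ≡ pred b) G
  BlockFits highDead G = All (λ y → proj₁ y ≡ pred a) G
  BlockFits (run x)  G = All (_≡ x) G × 0 < length G

  data Fits : List Block → List Gap → Set where
    []  : Fits [] []
    fit : ∀ {B Bs G} G₁ G₂ → G ≡ G₁ ++ G₂ → BlockFits B G₁ → Fits Bs G₂ → Fits (B ∷ Bs) G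

  -- Block 0 is the low dead end, so the i-th listed run is block i + 1.
  shape : List Gap → List Block
  shape xs = lowDead ∷ map run xs ++ [ highDead ]

  blockAt : List Block → ℕ → Maybe Block
  blockAt []       j       = nothing
  blockAt (B ∷ Bs) zero    = just B
  blockAt (B ∷ Bs) (suc j) = blockAt Bs j

  blockBelow blockAbove : Gap → Block → Block
  blockBelow x (run y) = run (gapBelow x y)
  blockBelow x B       = B
  blockAbove x (run y) = run (gapAbove x y)
  blockAbove x B       = B

  playBlocks : Gap → ℕ → List Block → List Block
  playBlocks x j       []       = []
  playBlocks x zero    (B ∷ Bs) =
    run (gapBelow x x) ∷ run (gapAbove x x) ∷ map (blockAbove x) Bs
  playBlocks x (suc j) (B ∷ Bs) = blockBelow x B ∷ playBlocks x j Bs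

  lowDead-unsafe : ∀ {f g} → g ≡ pred b → ¬ Safe (f , g)
  lowDead-unsafe refl (_ , sg<b) = suc-pred≮ b sg<b

  highDead-unsafe : ∀ {f g} → f ≡ pred a → ¬ Safe (f , g)
  highDead-unsafe refl (sf<a , _) = suc-pred≮ a sf<a

  blockFits-below : ∀ {x B G} → Safe x → BlockFits B G →
                    BlockFits (blockBelow x B) (map (gapBelow x) G)
  blockFits-below {B = lowDead}  (_ , sg<b) ys =
    Allₚ.map⁺ (All.map (λ { refl → m≥n⇒m⊔n≡m (<⇒≤pred sg<b) }) ys)
  blockFits-below {B = highDead} _          ys = Allₚ.map⁺ ys
  blockFits-below {x} {run y} {G} _ (ys , ne) =
    Allₚ.map⁺ (All.map (cong (gapBelow x)) ys) , subst (0 <_) (sym (length-map (gapBelow x) G)) ne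

  blockFits-above : ∀ {x B G} → Safe x → BlockFits B G →
                    BlockFits (blockAbove x B) (map (gapAbove x) G)
  blockFits-above {B = lowDead}  _          ys = Allₚ.map⁺ ys
  blockFits-above {B = highDead} (sf<a , _) ys =
    Allₚ.map⁺ (All.map (λ { refl → m≥n⇒m⊔n≡m (<⇒≤pred sf<a) }) ys)
  blockFits-above {x} {run y} {G} _ (ys , ne) =
    Allₚ.map⁺ (All.map (cong (gapAbove x)) ys) , subst (0 <_) (sym (length-map (gapAbove x) G)) ne

  fits-above : ∀ {x Bs G} → Safe x → Fits Bs G →
               Fits (map (blockAbove x) Bs) (map (gapAbove x) G)
  fits-above _ [] = []
  fits-above {x} safe (fit G₁ G₂ refl fits₁ fits₂) =
    fit (map (gapAbove x) G₁) (map (gapAbove x) G₂) (map-++ (gapAbove x) G₁ G₂)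
      (blockFits-above safe fits₁) (fits-above safe fits₂)

  fits-play-in-run : ∀ {x Bs L R G} → Safe x → All (_≡ x) L → All (_≡ x) R → Fits Bs G →
                     Fits (playBlocks x 0 (run x ∷ Bs)) (playAt x (length L) (L ++ x ∷ R ++ G))
  fits-play-in-run {x} {R = R} {G} safe [] R≡x fits =
    fit [ gapBelow x x ] (map (gapAbove x) (x ∷ R ++ G)) refl (refl ∷ [] , s≤s z≤n)
      (fit (map (gapAbove x) (x ∷ R)) (map (gapAbove x) G) (map-++ (gapAbove x) (x ∷ R) G)
        (Allₚ.map⁺ (All.map (cong (gapAbove x)) (refl ∷ R≡x)) , s≤s z≤n) (fits-above safe fits))
  fits-play-in-run {x} safe (refl ∷ L≡x) R≡x fits with fits-play-in-run safe L≡x R≡x fits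
  ... | fit G₁ G₂ eq (ys , _) fits′ =
    fit (gapBelow x x ∷ G₁) G₂ (cong (gapBelow x x ∷_) eq) (refl ∷ ys , s≤s z≤n) fits′

  MoveInRun : List Block → List Gap → ℕ → Set
  MoveInRun Bs G m = ∃₂ λ j x → blockAt Bs j ≡ just (run x) × gapAt G m ≡ x × Safe x ×
                                Fits (playBlocks x j Bs) (playAt x m G)

  fits-play-first : ∀ B {Bs G₁ G₂ m} → BlockFits B G₁ → Fits Bs G₂ → m < length G₁ →
                    Safe (gapAt (G₁ ++ G₂) m) → MoveInRun (B ∷ Bs) (G₁ ++ G₂) m
  fits-play-first lowDead {G₁ = G₁} ys _ m<G₁ safe =
    contradiction (subst Safe (gapAt-++ˡ G₁ m<G₁) safe) (lowDead-unsafe (gapAt-All ys m<G₁))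
  fits-play-first highDead {G₁ = G₁} ys _ m<G₁ safe =
    contradiction (subst Safe (gapAt-++ˡ G₁ m<G₁) safe) (highDead-unsafe (gapAt-All ys m<G₁))
  fits-play-first (run x) {Bs} {G₁} {G₂} (xs , _) fits₂ m<G₁ safe
    with trans (gapAt-++ˡ G₁ m<G₁) (gapAt-All xs m<G₁) | All≡-split xs m<G₁
  ... | eq | L , R , refl , refl , L≡x , R≡x =
    0 , x , refl , eq , safeˣ ,
    subst (λ G → Fits (playBlocks x 0 (run x ∷ Bs)) (playAt x (length L) G))
          (sym (++-assoc L (x ∷ R) G₂)) (fits-play-in-run safeˣ L≡x R≡x fits₂)
    where safeˣ = subst Safe eq safe

  fits-play : ∀ {Bs G m} → Fits Bs G → m < length G → Safe (gapAt G m) → MoveInRun Bs G m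
  fits-play [] ()
  fits-play {B ∷ Bs} {m = m} (fit G₁ G₂ refl fits₁ fits₂) m<G safe with m <? length G₁
  ... | yes m<G₁ = fits-play-first B fits₁ fits₂ m<G₁ safe
  ... | no m≮G₁ with m≤n⇒∃[o]m+o≡n (≮⇒≥ m≮G₁)
  ...   | m′ , refl
    with fits-play fits₂ (+-cancelˡ-< (length G₁) _ _ (subst (_ <_) (length-++ G₁) m<G))
                         (subst Safe (gapAt-++ʳ G₁) safe)
  ...     | j , x , at , eq , safeˣ , fits =
    suc j , x , at , trans (gapAt-++ʳ G₁) eq , safeˣ ,
    fit (map (gapBelow x) G₁) (playAt x m′ G₂) (playAt-++ʳ x G₁) (blockFits-below safeˣ fits₁) fits

  fits-play-run : ∀ {Bs G j x} → Fits Bs G → blockAt Bs j ≡ just (run x) → Safe x →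
                  ∃ λ m → m < length G × gapAt G m ≡ x × Fits (playBlocks x j Bs) (playAt x m G)
  fits-play-run {j = zero} (fit [] _ _ (_ , ()) _) refl _
  fits-play-run {j = zero} (fit (_ ∷ R) _ refl (refl ∷ R≡x , _) fits₂) refl safe =
    0 , s≤s z≤n , refl , fits-play-in-run safe [] R≡x fits₂
  fits-play-run {j = suc j} {x} (fit G₁ G₂ refl fits₁ fits₂) at safe
    with fits-play-run fits₂ at safe
  ... | m , m<G₂ , eq , fits =
    length G₁ + m , subst (_ <_) (sym (length-++ G₁)) (+-monoʳ-< (length G₁) m<G₂) ,
    trans (gapAt-++ʳ G₁) eq ,
    fit (map (gapBelow x) G₁) (playAt x m G₂) (playAt-++ʳ x G₁) (blockFits-below safe fits₁) fits

  -- Coarsenings of shapes, which bring the shape after a move back to a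
  -- normal form; relabel is needed because ⊔ on symbolic values does not reduce.
  infix 4 _↝_
  data _↝_ : List Block → List Block → Set where
    stop        : ∀ {Bs} → Bs ↝ Bs
    keep        : ∀ {B Bs Cs} → Bs ↝ Cs → B ∷ Bs ↝ B ∷ Cs
    relabel     : ∀ {f f′ g Bs Cs} → f ≡ f′ → run (f′ , g) ∷ Bs ↝ Cs → run (f , g) ∷ Bs ↝ Cs
    to-high     : ∀ {f g Bs Cs} → f ≡ pred a → highDead ∷ Bs ↝ Cs → run (f , g) ∷ Bs ↝ Cs
    absorb-low  : ∀ {f Bs Cs} → lowDead ∷ Bs ↝ Cs → lowDead ∷ run (f , pred b) ∷ Bs ↝ Cs
    absorb-high : ∀ {f g Bs Cs} → f ≡ pred a → highDead ∷ Bs ↝ Cs →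
                  highDead ∷ run (f , g) ∷ Bs ↝ Cs
    merge-high  : ∀ {Bs Cs} → highDead ∷ Bs ↝ Cs → highDead ∷ highDead ∷ Bs ↝ Cs
    merge-run   : ∀ {f f′ g Bs Cs} → f′ ≡ f → run (f , g) ∷ Bs ↝ Cs →
                  run (f , g) ∷ run (f′ , g) ∷ Bs ↝ Cs

  fits-merge : ∀ B C {Bs G} → Fits (B ∷ C ∷ Bs) G →
               (∀ {G₁ G₂} → BlockFits B G₁ → BlockFits C G₂ → BlockFits B (G₁ ++ G₂)) →
               Fits (B ∷ Bs) G
  fits-merge _ _ (fit G₁ _ refl fits₁ (fit G₂ G₃ refl fits₂ fits₃)) join =
    fit (G₁ ++ G₂) G₃ (sym (++-assoc G₁ G₂ G₃)) (join fits₁ fits₂) fits₃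

  run-++ : ∀ {x G₁ G₂} → BlockFits (run x) G₁ → BlockFits (run x) G₂ →
           BlockFits (run x) (G₁ ++ G₂)
  run-++ {G₁ = _ ∷ _} (xs , _) (ys , _) = Allₚ.++⁺ xs ys , s≤s z≤n

  reshape : ∀ {Bs Cs G} → Bs ↝ Cs → Fits Bs G → Fits Cs G
  reshape stop                 fits = fits
  reshape (keep r)             (fit G₁ G₂ eq fits₁ fits₂) = fit G₁ G₂ eq fits₁ (reshape r fits₂)
  reshape (relabel refl r)     fits = reshape r fits
  reshape (to-high refl r)     (fit G₁ G₂ eq (ys , _) fits₂) =
    reshape r (fit G₁ G₂ eq (All.map (cong proj₁) ys) fits₂)
  reshape (absorb-low r)       fits =
    reshape r (fits-merge lowDead (run _) fits λ zs (ys , _) → Allₚ.++⁺ zs (All.map (cong proj₂) ys))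
  reshape (absorb-high refl r) fits =
    reshape r (fits-merge highDead (run _) fits λ zs (ys , _) → Allₚ.++⁺ zs (All.map (cong proj₁) ys))
  reshape (merge-high r)       fits = reshape r (fits-merge highDead highDead fits Allₚ.++⁺)
  reshape (merge-run refl r)   fits = reshape r (fits-merge (run _) (run _) fits run-++)

  Loses Wins : List Block → Set
  Loses Bs = ∀ {G} → Fits Bs G → ProfileLose G
  Wins  Bs = ∀ {G} → Fits Bs G → ProfileWin G

  loses-if-answered : ∀ {Bs} →
                      (∀ j {x} → blockAt Bs j ≡ just (run x) → Safe x → Wins (playBlocks x j Bs)) →
                      Loses Bs
  loses-if-answered {Bs} answers {G} fits = lose-by reply
    where
      reply : ∀ m → m < length G → ¬ Safe (gapAt G m) ⊎ ProfileWin (play G m)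
      reply m m<G with safe? (gapAt G m)
      ... | no unsafe = inj₁ unsafe
      ... | yes safe with fits-play fits m<G safe
      ...   | j , x , at , eq , safeˣ , fits′ =
        inj₂ (subst (λ y → ProfileWin (playAt y m G)) (sym eq) (answers j at safeˣ fits′))

  answer : ∀ {Bs} Cs → Bs ↝ Cs → ∀ j {x} → blockAt Cs j ≡ just (run x) → Safe x →
           ∀ {Ds} → playBlocks x j Cs ↝ Ds → Loses Ds → Wins Bs
  answer Cs r j at safe r′ loses fits with fits-play-run (reshape r fits) at safe
  ... | m , m<G , eq , fits′ =
    win-at m m<G (subst Safe (sym eq) safe)
      (subst (λ y → ProfileLose (playAt y m _)) (sym eq) (loses (reshape r′ fits′)))

  wins-reshape : ∀ {Bs Cs} → Bs ↝ Cs → Wins Cs → Wins Bs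
  wins-reshape r wins fits = wins (reshape r fits)

module Strategy (n : ℕ) where

  open ProfileGame (4 + n) 4 public
  open Shapes (4 + n) 4

  live : ∀ {f g} → f ≤ 2 + n → g ≤ 2 → Safe (f , g)
  live f≤ g≤ = s≤s (s≤s f≤) , s≤s (s≤s g≤)

  opening shapeC shapeX dead : List Block
  opening = shape ((0 , 1) ∷ (1 , 0) ∷ [])
  shapeC  = shape ((1 + n , 2) ∷ (2 + n , 1) ∷ [])
  shapeX  = shape ((2 + n , 2) ∷ (2 + n , 1) ∷ (2 + n , 0) ∷ [])
  dead    = shape []

  shapeA shapeB : ℕ → List Block
  shapeA k = shape ((k , 2) ∷ (k , 1) ∷ (1 + k , 0) ∷ [])
  shapeB k = shape ((k , 2) ∷ (1 + k , 2) ∷ (2 + k , 1) ∷ (2 + k , 0) ∷ [])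

  dead-loses : Loses dead
  dead-loses = loses-if-answered λ { zero () ; (suc zero) () ; (suc (suc _)) () }

  C-loses : Loses shapeC
  C-loses = loses-if-answered λ
    { zero ()
    ; (suc zero) refl _ →
        answer (shape ((2 + n , 2) ∷ (2 + n , 1) ∷ []))
          (absorb-low (keep (relabel (shift-⊔ 1 2) (keep (relabel (shift-⊔ 2 2) (keep stop))))))
          1 refl (live ≤-refl ≤-refl)
          (absorb-low (keep (to-high (shift-⊔ 2 3) (absorb-high (shift-⊔ 2 3) (merge-high stop)))))
          dead-loses
    ; (suc (suc zero)) refl _ →
        answer (shape ((1 + n , 2) ∷ (2 + n , 2) ∷ []))
          (keep (keep (keep (to-high (shift-⊔ 2 3) (merge-high stop)))))
          2 refl (live ≤-refl ≤-refl)
          (absorb-low (absorb-low (keep (to-high (shift-⊔ 2 3) (merge-high stop)))))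
          dead-loses
    ; (suc (suc (suc zero))) ()
    ; (suc (suc (suc (suc _)))) ()
    }

  X-wins : Wins shapeX
  X-wins = answer shapeX stop 1 refl (live ≤-refl ≤-refl)
    (absorb-low (keep (to-high (shift-⊔ 2 3)
      (absorb-high (shift-⊔ 2 3) (absorb-high (shift-⊔ 2 3) (merge-high stop))))))
    dead-loses

  A-top-loses : Loses (shapeA (1 + n))
  A-top-loses = loses-if-answered λ
    { zero ()
    ; (suc zero) refl _ →
        wins-reshape
          (absorb-low (keep (relabel (shift-⊔ 1 2) (keep (relabel (shift-⊔ 1 2)
            (keep (relabel (shift-⊔ 2 2) (keep stop))))))))
          X-wins
    ; (suc (suc zero)) refl _ →
        answer (shape ((1 + n , 2) ∷ (2 + n , 1) ∷ (2 + n , 0) ∷ []))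
          (keep (merge-run refl (keep (relabel (shift-⊔ 1 2) (keep (relabel (shift-⊔ 2 2) (keep stop)))))))
          3 refl (live ≤-refl z≤n)
          (keep (keep (merge-run refl (keep (to-high (shift-⊔ 2 3) (merge-high stop))))))
          C-loses
    ; (suc (suc (suc zero))) refl _ →
        answer (shape ((1 + n , 2) ∷ (1 + n , 1) ∷ (2 + n , 1) ∷ []))
          (keep (keep (keep (keep (to-high (shift-⊔ 2 3) (merge-high stop))))))
          2 refl (live (n≤1+n _) (s≤s z≤n))
          (keep (merge-run refl (keep (relabel (shift-⊔ 1 2) (merge-run (shift-⊔ 2 2) (keep stop))))))
          C-loses
    ; (suc (suc (suc (suc zero)))) ()
    ; (suc (suc (suc (suc (suc _))))) ()
    }

  B-top-loses : Loses (shapeB n)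
  B-top-loses = loses-if-answered λ
    { zero ()
    ; (suc zero) refl _ →
        answer (shape ((1 + n , 2) ∷ (2 + n , 1) ∷ (2 + n , 0) ∷ []))
          (absorb-low (keep (relabel (shift-⊔ 0 1) (merge-run (shift-⊔ 1 1)
            (keep (relabel (shift-⊔ 2 1) (keep (relabel (shift-⊔ 2 1) (keep stop)))))))))
          3 refl (live ≤-refl z≤n)
          (keep (keep (merge-run refl (keep (to-high (shift-⊔ 2 3) (merge-high stop))))))
          C-loses
    ; (suc (suc zero)) refl _ →
        wins-reshape
          (absorb-low (absorb-low (keep (relabel (shift-⊔ 1 2)
            (keep (relabel (shift-⊔ 2 2) (keep (relabel (shift-⊔ 2 2) (keep stop)))))))))
          X-wins
    ; (suc (suc (suc zero))) refl _ →
        answer (shape ((n , 2) ∷ (1 + n , 2) ∷ (2 + n , 2) ∷ []))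
          (keep (keep (keep (keep (to-high (shift-⊔ 2 3) (absorb-high (shift-⊔ 2 3) (merge-high stop)))))))
          3 refl (live ≤-refl ≤-refl)
          (absorb-low (absorb-low (absorb-low (keep (to-high (shift-⊔ 2 3) (merge-high stop))))))
          dead-loses
    ; (suc (suc (suc (suc zero)))) refl _ →
        answer (shape ((n , 2) ∷ (1 + n , 2) ∷ (2 + n , 1) ∷ []))
          (keep (keep (keep (merge-run refl (keep (to-high (shift-⊔ 2 3) (merge-high stop)))))))
          1 refl (live (≤-trans (n≤1+n n) (n≤1+n _)) ≤-refl)
          (absorb-low (keep (relabel (shift-⊔ 0 1) (merge-run (shift-⊔ 1 1)
            (keep (relabel (shift-⊔ 2 1) (keep stop)))))))
          C-loses
    ; (suc (suc (suc (suc (suc zero))))) ()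
    ; (suc (suc (suc (suc (suc (suc _)))))) ()
    }

  mutual
    A-loses : ∀ d k → k + d ≡ 1 + n → Loses (shapeA k)
    A-loses zero k eq = subst (Loses ∘ shapeA) (trans (sym eq) (+-identityʳ k)) A-top-loses
    A-loses (suc d) k eq = loses-if-answered λ
      { zero ()
      ; (suc zero) refl _ →
          answer (shape ((1 + k , 2) ∷ (1 + k , 1) ∷ (1 + k , 0) ∷ []))
            (absorb-low (keep (relabel (shift-⊔ 0 1) (keep (relabel (shift-⊔ 0 1)
              (keep (relabel (shift-⊔ 1 1) (keep stop))))))))
            3 refl (live (s≤s k≤1+n) z≤n)
            (keep (keep (merge-run refl (keep (relabel (shift-⊔ 1 2) (keep stop))))))
            (A-loses d (1 + k) eq′)
      ; (suc (suc zero)) refl _ →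
          answer (shape ((k , 2) ∷ (1 + k , 1) ∷ (1 + k , 0) ∷ []))
            (keep (merge-run refl (keep (relabel (shift-⊔ 0 1) (keep (relabel (shift-⊔ 1 1) (keep stop)))))))
            2 refl (live (s≤s k≤1+n) (s≤s z≤n))
            (keep (keep (keep (relabel (shift-⊔ 1 2) (keep (relabel (shift-⊔ 1 2) (keep stop)))))))
            (B-loses d k (suc-injective eq′))
      ; (suc (suc (suc zero))) refl _ →
          answer (shape ((k , 2) ∷ (k , 1) ∷ (1 + k , 1) ∷ (2 + k , 0) ∷ []))
            (keep (keep (keep (keep (relabel (shift-⊔ 1 2) (keep stop))))))
            1 refl (live (≤-trans k≤1+n (n≤1+n _)) ≤-refl)
            (absorb-low (keep (relabel (shift-⊔ 0 1) (keep (relabel (shift-⊔ 0 1) (merge-run (shift-⊔ 1 1)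
              (keep (relabel (shift-⊔ 2 1) (keep stop)))))))))
            (A-loses d (1 + k) eq′)
      ; (suc (suc (suc (suc zero)))) ()
      ; (suc (suc (suc (suc (suc _))))) ()
      }
      where
        eq′ : 1 + k + d ≡ 1 + n
        eq′ = trans (sym (+-suc k d)) eq
        k≤1+n : k ≤ 1 + n
        k≤1+n = subst (k ≤_) eq (m≤m+n k (suc d))

    B-loses : ∀ e k → k + e ≡ n → Loses (shapeB k)
    B-loses zero k eq = subst (Loses ∘ shapeB) (trans (sym eq) (+-identityʳ k)) B-top-loses
    B-loses (suc e) k eq = loses-if-answered λ
      { zero ()
      ; (suc zero) refl _ →
          answer (shape ((1 + k , 2) ∷ (2 + k , 1) ∷ (2 + k , 0) ∷ []))
            (absorb-low (keep (relabel (shift-⊔ 0 1) (merge-run (shift-⊔ 1 1)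
              (keep (relabel (shift-⊔ 2 1) (keep (relabel (shift-⊔ 2 1) (keep stop)))))))))
            2 refl (live (s≤s (s≤s k≤n)) (s≤s z≤n))
            (keep (keep (keep (relabel (shift-⊔ 2 3) (keep (relabel (shift-⊔ 2 3) (keep stop)))))))
            (B-loses e (1 + k) eq′)
      ; (suc (suc zero)) refl _ →
          answer (shape ((2 + k , 2) ∷ (2 + k , 1) ∷ (2 + k , 0) ∷ []))
            (absorb-low (absorb-low (keep (relabel (shift-⊔ 1 2)
              (keep (relabel (shift-⊔ 2 2) (keep (relabel (shift-⊔ 2 2) (keep stop)))))))))
            3 refl (live (s≤s (s≤s k≤n)) z≤n)
            (keep (keep (merge-run refl (keep (relabel (shift-⊔ 2 3) (keep stop))))))
            (A-loses e (2 + k) (cong suc eq′))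
      ; (suc (suc (suc zero))) refl _ →
          answer (shape ((k , 2) ∷ (1 + k , 2) ∷ (2 + k , 2) ∷ (3 + k , 1) ∷ (3 + k , 0) ∷ []))
            (keep (keep (keep (keep (relabel (shift-⊔ 2 3) (keep (relabel (shift-⊔ 2 3) (keep stop))))))))
            1 refl (live (≤-trans k≤n (≤-trans (n≤1+n _) (n≤1+n _))) ≤-refl)
            (absorb-low (keep (relabel (shift-⊔ 0 1) (merge-run (shift-⊔ 1 1) (keep (relabel (shift-⊔ 2 1)
              (keep (relabel (shift-⊔ 3 1) (keep (relabel (shift-⊔ 3 1) (keep stop)))))))))))
            (B-loses e (1 + k) eq′)
      ; (suc (suc (suc (suc zero)))) refl _ →
          answer (shape ((k , 2) ∷ (1 + k , 2) ∷ (2 + k , 1) ∷ (3 + k , 0) ∷ []))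
            (keep (keep (keep (merge-run refl (keep (relabel (shift-⊔ 2 3) (keep stop)))))))
            2 refl (live (s≤s (≤-trans k≤n (n≤1+n _))) ≤-refl)
            (absorb-low (absorb-low (keep (relabel (shift-⊔ 1 2) (keep (relabel (shift-⊔ 2 2)
              (keep (relabel (shift-⊔ 3 2) (keep stop)))))))))
            (A-loses e (2 + k) (cong suc eq′))
      ; (suc (suc (suc (suc (suc zero))))) ()
      ; (suc (suc (suc (suc (suc (suc _)))))) ()
      }
      where
        eq′ : 1 + k + e ≡ n
        eq′ = trans (sym (+-suc k e)) eq
        k≤n : k ≤ n
        k≤n = subst (k ≤_) eq (m≤m+n k (suc e))

  opening-loses : Loses opening
  opening-loses = loses-if-answered λ
    { zero ()
    ; (suc zero) refl _ →
        answer (shape ((0 , 2) ∷ (1 , 1) ∷ (1 , 0) ∷ [])) stop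
          2 refl (live (s≤s z≤n) (s≤s z≤n)) stop (B-loses n 0 refl)
    ; (suc (suc zero)) refl _ →
        answer (shape ((0 , 1) ∷ (1 , 1) ∷ (2 , 0) ∷ [])) stop
          2 refl (live (s≤s z≤n) (s≤s z≤n)) stop (B-loses n 0 refl)
    ; (suc (suc (suc zero))) ()
    ; (suc (suc (suc (suc _)))) ()
    }

  first-move-wins : ProfileWin [ (0 , 0) ]
  first-move-wins = win-at 0 (s≤s z≤n) (live z≤n z≤n) (opening-loses fits)
    where
      fits : Fits opening ((0 , 1) ∷ (1 , 0) ∷ [])
      fits = fit [] _ refl [] (fit [ (0 , 1) ] _ refl (refl ∷ [] , s≤s z≤n)
               (fit [ (1 , 0) ] [] refl (refl ∷ [] , s≤s z≤n) (fit [] [] refl [] [])))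

theorem3 : (a : ℕ) → 4 ≤ a → Player1Wins a 4
theorem3 .(4 + n) (s≤s (s≤s (s≤s (s≤s {n = n} z≤n)))) =
  win-from (represents-[] (s≤s z≤n) (s≤s z≤n)) first-move-wins
  where open Strategy n
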